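{- Let $n,h\ge 2$. The Borda SCC $Bor$ and the Copeland SCC $Cop$ are both immune to the reversal bias of type 3; that is, for every $p\in\mathcal{P}$, if $Bor(p)\cap Bor(p^r)\ne\varnothing$ then $Bor(p)=N$, and if $Cop(p)\cap Cop(p^r)\ne\varnothing$ then $Cop(p)=N$.
   Context: $N=\{1,\dots,n\}$, $H=\{1,\dots,h\}$, $\mathcal{P}=\mathcal{L}(N)^h$ where $\mathcal{L}(N)$ is the set of linear orders on $N$. For $q\in\mathcal{L}(N)$, $\mathrm{rank}_q(x)=|\{y: y>_q x\}|+1$; $q^r$ is the reversed order and $p^r=(p_1^r,\dots,p_h^r)$. $\mu_0=\lceil (h+1)/2\rceil$ and $x>^p_{\mu_0}y$ means $|\{i\in H:x>_{p_i}y\}|\ge\mu_0$. $Bor(p)=\mathrm{argmax}_{x\in N}\sum_{i=1}^h(n-\mathrm{rank}_{p_i}(x))$ and $Cop(p)=\mathrm{argmax}_{x\in N}\big(|\{y: x>^p_{\mu_0}y\}|-|\{y: y>^p_{\mu_0}x\}|\big)$. An SCC $C$ suffers the reversal bias of type 3 if there exists $p$ with $|C(p)|<n$ and $C(p)\cap C(p^r)\ne\varnothing$. -}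

module Defs where

open import Data.Nat using (ℕ; suc; _∸_; _<_; _≤_; _<?_; _≤?_; ⌈_/2⌉)
open import Data.Fin using (Fin; toℕ)
open import Data.Fin.Permutation using (Permutation; _⟨$⟩ʳ_; _∘ₚ_; reverse)
open import Data.List using (List; map; length; filter; allFin)
open import Data.Nat.ListAction using (sum)
open import Relation.Nullary using (Dec)
open import Data.Integer using (ℤ; +_; _-_) renaming (_≤_ to _≤ℤ_)
open import Data.Product using (∃; _×_)

-- A linear order q on N = Fin n, encoded by its rank map:
-- q ⟨$⟩ʳ x is the 0-based position of x (0 = top), so that
-- rank_q(x) = |{y : y >_q x}| + 1 = suc (toℕ (q ⟨$⟩ʳ x)).
LinOrd : ℕ → Set
LinOrd n = Permutation n n

rank : ∀ {n} → LinOrd n → Fin n → ℕ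
rank q x = suc (toℕ (q ⟨$⟩ʳ x))

_≻[_]_ : ∀ {n} → Fin n → LinOrd n → Fin n → Set
x ≻[ q ] y = rank q x < rank q y

-- reversed order q^r : rank_{q^r}(x) = n + 1 - rank_q(x)
rev : ∀ {n} → LinOrd n → LinOrd n
rev q = q ∘ₚ reverse

Profile : ℕ → ℕ → Set
Profile n h = Fin h → LinOrd n

revP : ∀ {n h} → Profile n h → Profile n h
revP p i = rev (p i)

bordaScore : ∀ {n h} → Profile n h → Fin n → ℕ
bordaScore {n} {h} p x = sum (map (λ i → n ∸ rank (p i) x) (allFin h))

Bor : ∀ {n h} → Profile n h → Fin n → Set
Bor p x = ∀ y → bordaScore p y ≤ bordaScore p x

μ₀ : ℕ → ℕ
μ₀ h = ⌈ suc h /2⌉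

supporters : ∀ {n h} → Profile n h → Fin n → Fin n → ℕ
supporters {n} {h} p x y =
  length (filter (λ i → rank (p i) x <? rank (p i) y) (allFin h))

_>maj[_]_ : ∀ {n h} → Fin n → Profile n h → Fin n → Set
_>maj[_]_ {n} {h} x p y = μ₀ h ≤ supporters p x y

majority? : ∀ {n h} (p : Profile n h) (x y : Fin n) → Dec (x >maj[ p ] y)
majority? {n} {h} p x y = μ₀ h ≤? supporters p x y

copelandScore : ∀ {n h} → Profile n h → Fin n → ℤ
copelandScore {n} p x =
  (+ length (filter (λ y → majority? p x y) (allFin n)))
  - (+ length (filter (λ y → majority? p y x) (allFin n)))

Cop : ∀ {n h} → Profile n h → Fin n → Set
Cop p x = ∀ y → copelandScore p y ≤ℤ copelandScore p x

-- Reversing a voter's order swaps the roles of x and y in every pairwise comparison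
-- and turns the Borda points n - rank(x) into rank(x) - 1.  Hence the Borda scores
-- of x under p and under p^r add up to the constant h(n - 1), and the Copeland score
-- under p^r is the negative of the one under p.  An alternative maximising both a
-- score s and a complementary score c - s also minimises s, so s is constant and
-- every alternative wins.
module Submission where

open import Defs
open import Data.Nat using (ℕ; _≤_; suc; _+_; _∸_; _<_; s<s; s<s⁻¹)
open import Data.Nat.Properties
  using (+-comm; +-commutativeSemigroup; m+[n∸m]≡n; ∸-monoʳ-<; ∸-cancelʳ-<; +-cancelʳ-≤; +-monoʳ-≤; ≤-trans)
open import Data.Nat.ListAction using (sum)
open import Data.Fin using (Fin; toℕ; opposite)
open import Data.Fin.Properties using (opposite-prop; opposite-involutive; toℕ≤pred[n]; toℕ<n)
open import Data.Fin.Permutation using (_⟨$⟩ʳ_)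
open import Data.List using (List; []; _∷_; map; length; filter; allFin)
open import Data.List.Properties using (filter-≐; map-cong)
open import Data.Integer as ℤ using (ℤ) renaming (_≤_ to _≤ℤ_)
import Data.Integer.Properties as ℤ
open import Algebra.Properties.CommutativeSemigroup +-commutativeSemigroup
  using () renaming (interchange to +-interchange)
open import Algebra.Properties.AbelianGroup ℤ.+-0-abelianGroup using (⁻¹-anti-homo‿-)
open import Data.Product using (∃; _×_; _,_)
open import Function.Bundles using (_⇔_; mk⇔; Equivalence)
open import Relation.Unary using (Decidable)
open import Relation.Binary.PropositionalEquality
  using (_≡_; refl; sym; trans; cong; cong₂; subst; subst₂; module ≡-Reasoning)

toℕ+toℕ-opposite : ∀ {n} (i : Fin n) → toℕ i + toℕ (opposite i) ≡ n ∸ 1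
toℕ+toℕ-opposite {suc n} i =
  trans (cong (toℕ i +_) (opposite-prop i)) (m+[n∸m]≡n (toℕ≤pred[n] i))

toℕ-opposite-<⇔> : ∀ {n} (i j : Fin n) → toℕ (opposite i) < toℕ (opposite j) ⇔ toℕ j < toℕ i
toℕ-opposite-<⇔> {n} i j = mk⇔
  (λ lt → s<s⁻¹ (∸-cancelʳ-< {o = n} (subst₂ _<_ (opposite-prop i) (opposite-prop j) lt)))
  (λ lt → subst₂ _<_ (sym (opposite-prop i)) (sym (opposite-prop j))
                     (∸-monoʳ-< (s<s lt) (toℕ<n i)))

sum-map-+ : ∀ {A : Set} (f g : A → ℕ) (xs : List A) →
  sum (map f xs) + sum (map g xs) ≡ sum (map (λ a → f a + g a) xs)
sum-map-+ f g [] = refl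
sum-map-+ f g (a ∷ xs) = begin
  (f a + sum (map f xs)) + (g a + sum (map g xs))
    ≡⟨ +-interchange (f a) _ (g a) _ ⟩
  (f a + g a) + (sum (map f xs) + sum (map g xs))
    ≡⟨ cong ((f a + g a) +_) (sum-map-+ f g xs) ⟩
  (f a + g a) + sum (map (λ b → f b + g b) xs) ∎
  where open ≡-Reasoning

length-filter-⇔ : ∀ {A : Set} {P Q : A → Set} (P? : Decidable P) (Q? : Decidable Q) →
  (∀ a → P a ⇔ Q a) → ∀ xs → length (filter P? xs) ≡ length (filter Q? xs)
length-filter-⇔ P? Q? P⇔Q xs = cong length (filter-≐ P? Q?
  ((λ {a} → Equivalence.to (P⇔Q a)) , (λ {a} → Equivalence.from (P⇔Q a))) xs)

common-argmax⇒all-argmaxᴺ : ∀ {A : Set} (f g : A → ℕ) {c : ℕ} → (∀ a → f a + g a ≡ c) →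
  ∀ {x} → (∀ y → f y ≤ f x) → (∀ y → g y ≤ g x) → ∀ z y → f y ≤ f z
common-argmax⇒all-argmaxᴺ f g f+g≡c {x} fx-max gx-max z y = ≤-trans (fx-max y) fx≤fz
  where
  fx≤fz : f x ≤ f z
  fx≤fz = +-cancelʳ-≤ (g x) (f x) (f z)
    (subst (_≤ f z + g x) (trans (f+g≡c z) (sym (f+g≡c x))) (+-monoʳ-≤ (f z) (gx-max z)))

common-argmax⇒all-argmaxᶻ : ∀ {A : Set} (f g : A → ℤ) → (∀ a → g a ≡ ℤ.- f a) →
  ∀ {x} → (∀ y → f y ≤ℤ f x) → (∀ y → g y ≤ℤ g x) → ∀ z y → f y ≤ℤ f z
common-argmax⇒all-argmaxᶻ f g g≡-f fx-max gx-max z y =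
  ℤ.≤-trans (fx-max y) (ℤ.neg-cancel-≤ (subst₂ _≤ℤ_ (g≡-f z) (g≡-f _) (gx-max z)))

≻-rev⇔≺ : ∀ {n} (q : LinOrd n) (x y : Fin n) → x ≻[ rev q ] y ⇔ y ≻[ q ] x
≻-rev⇔≺ q x y = mk⇔ (λ lt → s<s (to (s<s⁻¹ lt))) (λ lt → s<s (from (s<s⁻¹ lt)))
  where open Equivalence (toℕ-opposite-<⇔> (q ⟨$⟩ʳ x) (q ⟨$⟩ʳ y))

bordaPoints≡toℕ-rev : ∀ {n} (q : LinOrd n) (x : Fin n) → n ∸ rank q x ≡ toℕ (rev q ⟨$⟩ʳ x)
bordaPoints≡toℕ-rev q x = sym (opposite-prop (q ⟨$⟩ʳ x))

bordaPoints+bordaPoints-rev : ∀ {n} (q : LinOrd n) (x : Fin n) →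
  (n ∸ rank q x) + (n ∸ rank (rev q) x) ≡ n ∸ 1
bordaPoints+bordaPoints-rev {n} q x = begin
  (n ∸ rank q x) + (n ∸ rank (rev q) x)
    ≡⟨ cong₂ _+_ (bordaPoints≡toℕ-rev q x) (bordaPoints≡toℕ-rev (rev q) x) ⟩
  toℕ (opposite i) + toℕ (opposite (opposite i))
    ≡⟨ cong (λ j → toℕ (opposite i) + toℕ j) (opposite-involutive i) ⟩
  toℕ (opposite i) + toℕ i
    ≡⟨ +-comm (toℕ (opposite i)) (toℕ i) ⟩
  toℕ i + toℕ (opposite i)
    ≡⟨ toℕ+toℕ-opposite i ⟩
  n ∸ 1 ∎
  where
  open ≡-Reasoning
  i = q ⟨$⟩ʳ x

bordaScore+bordaScore-rev : ∀ {n h} (p : Profile n h) (x : Fin n) →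
  bordaScore p x + bordaScore (revP p) x ≡ sum (map (λ _ → n ∸ 1) (allFin h))
bordaScore+bordaScore-rev {h = h} p x =
  trans (sum-map-+ _ _ (allFin h))
        (cong sum (map-cong (λ i → bordaPoints+bordaPoints-rev (p i) x) (allFin h)))

supporters-rev : ∀ {n h} (p : Profile n h) (x y : Fin n) →
  supporters (revP p) x y ≡ supporters p y x
supporters-rev {h = h} p x y = length-filter-⇔ _ _ (λ i → ≻-rev⇔≺ (p i) x y) (allFin h)

>maj-rev⇔<maj : ∀ {n h} (p : Profile n h) (x y : Fin n) → x >maj[ revP p ] y ⇔ y >maj[ p ] x
>maj-rev⇔<maj {h = h} p x y = mk⇔ (subst (μ₀ h ≤_) (supporters-rev p x y))
                                   (subst (μ₀ h ≤_) (sym (supporters-rev p x y)))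

copelandScore-rev : ∀ {n h} (p : Profile n h) (x : Fin n) →
  copelandScore (revP p) x ≡ ℤ.- copelandScore p x
copelandScore-rev {n} p x = begin
  ℤ.+ wins (revP p) ℤ.- ℤ.+ losses (revP p)
    ≡⟨ cong₂ (λ a b → ℤ.+ a ℤ.- ℤ.+ b)
             (length-filter-⇔ _ _ (>maj-rev⇔<maj p x) (allFin n))
             (length-filter-⇔ _ _ (λ y → >maj-rev⇔<maj p y x) (allFin n)) ⟩
  ℤ.+ losses p ℤ.- ℤ.+ wins p
    ≡⟨ ⁻¹-anti-homo‿- (ℤ.+ wins p) (ℤ.+ losses p) ⟨
  ℤ.- copelandScore p x ∎
  where
  open ≡-Reasoning
  wins losses : Profile n _ → ℕ
  wins   q = length (filter (λ y → majority? q x y) (allFin n))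
  losses q = length (filter (λ y → majority? q y x) (allFin n))

proposition3 : (n h : ℕ) → 2 ≤ n → 2 ≤ h → (p : Profile n h) →
    ((∃ λ (x : Fin n) → Bor p x × Bor (revP p) x) → (x : Fin n) → Bor p x)
    × ((∃ λ (x : Fin n) → Cop p x × Cop (revP p) x) → (x : Fin n) → Cop p x)
proposition3 n h _ _ p =
    (λ (x , x∈Bor , x∈Bor-rev) →
       common-argmax⇒all-argmaxᴺ (bordaScore p) (bordaScore (revP p))
         (bordaScore+bordaScore-rev p) x∈Bor x∈Bor-rev)
  , (λ (x , x∈Cop , x∈Cop-rev) →
       common-argmax⇒all-argmaxᶻ (copelandScore p) (copelandScore (revP p))
         (copelandScore-rev p) x∈Cop x∈Cop-rev)
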